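{- There exists a pushdown alphabet $\widetilde\Sigma$ such that for every $n\in\mathbb N$ there exists a language $L_n$ of infinite words that is defined by a \text{VLDL} formula over $\widetilde\Sigma$ of size polynomial in $n$, but every Büchi visibly pushdown automaton over $\widetilde\Sigma$ recognizing $L_n$ has a number of states at least exponential in $n$.
   Context: A pushdown alphabet is a finite alphabet $\Sigma$ partitioned as $\widetilde\Sigma=(\Sigma_c,\Sigma_r,\Sigma_l)$ into calls, returns and local actions (in the paper $\Sigma=2^P$ for a finite set $P$ of atomic propositions). A visibly pushdown system $(Q,\widetilde\Sigma,\Gamma,\Delta)$ has finite $Q$, finite stack alphabet $\Gamma\ni\bot$, $\Delta \subseteq (Q\times\Sigma_c\times Q\times(\Gamma\setminus\{\bot\}))\cup(Q\times\Sigma_r\times\Gamma\times Q)\cup(Q\times\Sigma_l\times Q)$; configurations $(q,\gamma)$, $\gamma\in(\Gamma\setminus\{\bot\})^*\bot$; an $a$-labeled edge from $(q,\gamma)$ to $(q',\gamma')$ exists iff: $a\in\Sigma_c$, $(q,a,q',A)\in\Delta$, $\gamma'=A\gamma$; or $a\in\Sigma_r$, $(q,a,\bot,q')\in\Delta$, $\gamma=\gamma'=\bot$; or $a\in\Sigma_r$, $(q,a,A,q')\in\Delta$, $A\ne\bot$, $\gamma=A\gamma'$; or $a\in\Sigma_l$, $(q,a,q')\in\Delta$, $\gamma=\gamma'$. A VPA $(Q,\widetilde\Sigma,\Gamma,\Delta,I,F)$ accepts a finite word if some run from $(q,\bot)$, $q\in I$, ends in $F$. A Büchi VPA (BVPA)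 is the same tuple on infinite words, accepting if some run from $(q,\bot)$, $q\in I$, visits $F$ infinitely often. \text{VLDL}: a testing VPA (TVPA) is a VPA with a function $t$ from states to \text{VLDL} formulas (acyclic nesting; default tautology). Formulas: $\varphi ::= p \mid \neg\varphi\mid\varphi\wedge\varphi\mid\varphi\vee\varphi\mid\langle\mathfrak B\rangle\varphi\mid[\mathfrak B]\varphi$, $p$ an atomic proposition. For $\alpha\in\Sigma^\omega$: $(\alpha,k)\models p$ iff $p\in\alpha_k$; $\mathcal R_{\mathfrak B}(\alpha)$ is the set of $(k,l)$ such that some initial accepting run $(q_k,\sigma_k)\cdots(q_l,\sigma_l)$ of $\mathfrak B$ on $\alpha_k\cdots\alpha_{l-1}$ satisfies $(\alpha,m)\models t(q_m)$ for all $m\in\{k,\dots,l\}$; $\langle\mathfrak B\rangle\varphi$ holds at $k$ iff some $l\ge k$ with $(k,l)\in\mathcal R_{\mathfrak B}(\alpha)$ has $(\alpha,l)\models\varphi$; $[\mathfrak B]\varphi$ holds at $k$ iff all such $l$ satisfy $\varphi$. $L(\varphi)=\{\alpha\mid(\alpha,0)\models\varphi\}$. The size of $\varphi$ is the number of subformulas (including tests and their subformulas) plus the number of states of automata occurring in $\varphi$. -}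

module Defs where

open import Data.Nat using (ℕ; zero; suc; _+_; _*_; _∸_; _^_; _≤_; _<_)
open import Data.Fin using (Fin)
open import Data.Fin.Subset using (Subset; _∈_)
open import Data.Bool using (Bool; true; false)
open import Data.Maybe using (Maybe; just; nothing)
open import Data.List using (List; []; _∷_)
open import Data.Product using (Σ; ∃; _×_; _,_; proj₁)
open import Data.Empty using (⊥)
open import Data.Unit using (⊤)
open import Data.Sum using (_⊎_)
open import Relation.Nullary using (¬_)
open import Relation.Binary.PropositionalEquality using (_≡_)
open import Function.Bundles using (_⇔_)

-- Pushdown alphabets.  Σ = 2^P with P = Fin m atomic propositions;
-- a letter is a subset of P.  The partition (Σ_c, Σ_r, Σ_l) is given
-- by a function assigning every letter its kind.

data Kind : Set where
  call ret loc : Kind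

Letter : ℕ → Set
Letter m = Subset m

record PushdownAlphabet : Set where
  field
    m    : ℕ
    kind : Letter m → Kind

Word : ℕ → Set
Word m = ℕ → Letter m

-- Visibly pushdown automata (states Fin nQ, stack symbols Fin nΓ
-- plus the bottom symbol ⊥, represented by `nothing`).
-- Δ is given by characteristic functions of the three transition kinds;
-- a transition is only used with letters of the matching kind.

record VPA (m : ℕ) : Set where
  field
    nQ    : ℕ
    nΓ    : ℕ
    δcall : Fin nQ → Letter m → Fin nQ → Fin nΓ → Bool
    δret  : Fin nQ → Letter m → Maybe (Fin nΓ) → Fin nQ → Bool
    δloc  : Fin nQ → Letter m → Fin nQ → Bool
    init  : Fin nQ → Bool
    final : Fin nQ → Bool

module _ {m : ℕ} (kind : Letter m → Kind) (A : VPA m) where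
  open VPA A

  -- configurations: state and stack above ⊥ (top first)
  Config : Set
  Config = Fin nQ × List (Fin nΓ)

  Step : Letter m → Config → Config → Set
  Step a (q , γ) (q' , γ') with kind a
  ... | call = Σ (Fin nΓ) λ B → (δcall q a q' B ≡ true) × (γ' ≡ B ∷ γ)
  ... | loc  = (δloc q a q' ≡ true) × (γ' ≡ γ)
  ... | ret  with γ
  ...   | []     = (δret q a nothing q' ≡ true) × (γ' ≡ [])
  ...   | B ∷ γ₀ = (δret q a (just B) q' ≡ true) × (γ' ≡ γ₀)

  BAccepts : Word m → Set
  BAccepts α = Σ (ℕ → Config) λ r →
      (init (proj₁ (r 0)) ≡ true)
    × (Data.Product.proj₂ (r 0) ≡ [])
    × (∀ i → Step (α i) (r i) (r (suc i)))
    × (∀ i → Σ ℕ λ j → (i ≤ j) × (final (proj₁ (r j)) ≡ true))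

  Recognizes : (Word m → Set) → Set
  Recognizes L = ∀ α → BAccepts α ⇔ L α

-- VLDL formulas and testing VPAs (mutually inductive; acyclic nesting
-- is automatic).  A state's test is `nothing` for the default test
-- (tautology) and `just φ` otherwise.

mutual
  data Formula (m : ℕ) : Set where
    atom : Fin m → Formula m
    ¬ᶠ_  : Formula m → Formula m
    _∧ᶠ_ : Formula m → Formula m → Formula m
    _∨ᶠ_ : Formula m → Formula m → Formula m
    ⟨_⟩_ : TVPA m → Formula m → Formula m
    [_]_ : TVPA m → Formula m → Formula m

  data TVPA (m : ℕ) : Set where
    tvpa : (A : VPA m) → (Fin (VPA.nQ A) → Maybe (Formula m)) → TVPA m

mutual
  Sat : ∀ {m} → (Letter m → Kind) → Word m → ℕ → Formula m → Set
  Sat kind α k (atom p)  = p ∈ α k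
  Sat kind α k (¬ᶠ φ)    = ¬ Sat kind α k φ
  Sat kind α k (φ ∧ᶠ ψ)  = Sat kind α k φ × Sat kind α k ψ
  Sat kind α k (φ ∨ᶠ ψ)  = Sat kind α k φ ⊎ Sat kind α k ψ
  Sat kind α k (⟨ B ⟩ φ) = Σ ℕ λ l → (k ≤ l) × InR kind α B k l × Sat kind α l φ
  Sat kind α k ([ B ] φ) = ∀ l → k ≤ l → InR kind α B k l → Sat kind α l φ

  SatTest : ∀ {m} → (Letter m → Kind) → Word m → ℕ → Maybe (Formula m) → Set
  SatTest kind α k nothing  = ⊤
  SatTest kind α k (just φ) = Sat kind α k φ

  -- (k , l) ∈ R_B(α): an initial accepting run of B on α_k ⋯ α_{l-1}
  -- (given as r i = configuration at position k + i) whose states'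
  -- tests hold at the respective positions k, …, l.
  InR : ∀ {m} → (Letter m → Kind) → Word m → TVPA m → ℕ → ℕ → Set
  InR kind α (tvpa A t) k l = Σ (ℕ → Config kind A) λ r →
      (VPA.init A (proj₁ (r 0)) ≡ true)
    × (Data.Product.proj₂ (r 0) ≡ [])
    × (∀ i → i < l ∸ k → Step kind A (α (k + i)) (r i) (r (suc i)))
    × (VPA.final A (proj₁ (r (l ∸ k))) ≡ true)
    × (∀ i → i ≤ l ∸ k → SatTest kind α (k + i) (t (proj₁ (r i))))

Lang : ∀ {m} → (Letter m → Kind) → Formula m → Word m → Set
Lang kind φ α = Sat kind α 0 φ

-- Size: subformulas counted as nodes of the syntax tree (including the
-- tests and their subformulas) plus the number of states of every
-- automaton occurring in φ.

sumFin : ∀ n → (Fin n → ℕ) → ℕ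
sumFin zero    f = 0
sumFin (suc n) f = f Fin.zero + sumFin n (λ i → f (Fin.suc i))

mutual
  size : ∀ {m} → Formula m → ℕ
  size (atom p)  = 1
  size (¬ᶠ φ)    = suc (size φ)
  size (φ ∧ᶠ ψ)  = suc (size φ + size ψ)
  size (φ ∨ᶠ ψ)  = suc (size φ + size ψ)
  size (⟨ B ⟩ φ) = suc (sizeA B + size φ)
  size ([ B ] φ) = suc (sizeA B + size φ)

  sizeA : ∀ {m} → TVPA m → ℕ
  sizeA (tvpa A t) = VPA.nQ A + sumFin (VPA.nQ A) (λ q → sizeT (t q))

  sizeT : ∀ {m} → Maybe (Formula m) → ℕ
  sizeT nothing  = 0
  sizeT (just φ) = size φ

module Submission where

-- Alphabet: one proposition p, every letter a local action.  The formula
--   periodic k = [anyPrefix] ((p ∧ ⟨counter k⟩ p) ∨ (¬p ∧ ⟨counter k⟩ ¬p))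
-- has size 2k + 15 and defines the words α with α (l + k) ≡ α l for all l,
-- because anyPrefix relates 0 to every position and counter k relates a
-- position l exactly to l + k.
--
-- Two accepting runs of a BVPA that
-- are in the same configuration at position N splice into an accepting
-- run of the spliced word; over a local alphabet stacks stay empty, so
-- equal states suffice.  Each of the 2^N bit patterns x : Fin N → Fin 2
-- gives an N-periodic word; if two distinct patterns reached the same
-- state at position N, the spliced word would be accepted but not
-- N-periodic.  Hence the state at N determines the pattern and every
-- recognizing BVPA has at least 2^N states.

open import Defs
open import Data.Nat using (ℕ; suc; _*_; _^_; _≤_)
open import Data.Product using (Σ; _×_)

open import Data.Nat using (zero; _+_; _∸_; _<_; z≤n; s≤s; _≡ᵇ_; NonZero; _<?_)
open import Data.Nat.Properties
  using (≤-refl; ≤-trans; <⇒≤; ≤-pred; ≤⇒≯; <-cmp; m≤n⇒m≤1+n; n<1+n;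
         m≤m+n; m≤n+m; m+n∸m≡n; m+[n∸m]≡n; +-identityʳ; +-mono-≤; *-monoˡ-≤; *-monoʳ-≤;
         m≤m*n; m≤n*m; m^n≢0; ≡ᵇ⇒≡; ≡⇒≡ᵇ; module ≤-Reasoning)
open import Data.Nat.DivMod using (_mod_; _%_; m<n⇒m%n≡m; [m+n]%n≡m%n)
open import Data.Nat.Tactic.RingSolver using (solve-∀)
open import Data.Fin using (Fin; toℕ; combine; finToFun; funToFin)
import Data.Fin as Fin
open import Data.Fin.Properties using (toℕ-fromℕ<; toℕ<n; toℕ-injective; funToFin-finToFin; injective⇒≤)
open import Data.Fin.Subset using (inside; outside; _∈_; _∉_)
open import Data.Fin.Subset.Properties using (_∈?_)
open import Data.Vec using (_∷_; [])
open import Data.Vec.Base using (here)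
open import Data.Bool using (true)
open import Data.Bool.Properties using (T-≡)
open import Data.Maybe using (Maybe; nothing)
open import Data.List using ([])
open import Data.Product using (_,_; proj₁; proj₂)
open import Data.Sum using (_⊎_; inj₁; inj₂)
open import Data.Empty using (⊥-elim)
open import Data.Unit using (tt)
open import Relation.Nullary using (yes; no; contradiction)
open import Relation.Binary.Definitions using (tri<; tri≈; tri>)
open import Relation.Binary.PropositionalEquality
  using (_≡_; refl; sym; trans; cong; cong₂; subst; _≗_; module ≡-Reasoning)
open import Function using (_∘_)
open import Function.Bundles using (Equivalence)
open import Function.Definitions using (Injective)

allLocal : ∀ {m} → Letter m → Kind
allLocal _ = loc

localAlphabet : PushdownAlphabet
localAlphabet = record { m = 1 ; kind = allLocal }

≡⇒≡ᵇ-true : ∀ {m n} → m ≡ n → (m ≡ᵇ n) ≡ true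
≡⇒≡ᵇ-true {m} {n} e = Equivalence.to T-≡ (≡⇒≡ᵇ m n e)

≡ᵇ-true⇒≡ : ∀ {m n} → (m ≡ᵇ n) ≡ true → m ≡ n
≡ᵇ-true⇒≡ {m} {n} e = ≡ᵇ⇒≡ m n (Equivalence.from T-≡ e)

mod-small : ∀ {N i} .{{_ : NonZero N}} → i < N → toℕ (i mod N) ≡ i
mod-small {N} {i} i<N = trans (toℕ-fromℕ< _) (m<n⇒m%n≡m i<N)

mod-shift : ∀ N i .{{_ : NonZero N}} → (i + N) mod N ≡ i mod N
mod-shift N i = toℕ-injective (begin
  toℕ ((i + N) mod N) ≡⟨ toℕ-fromℕ< _ ⟩
  (i + N) % N         ≡⟨ [m+n]%n≡m%n i N ⟩
  i % N               ≡⟨ sym (toℕ-fromℕ< _) ⟩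
  toℕ (i mod N)       ∎)
  where open ≡-Reasoning

cycle : ∀ {A : Set} N .{{_ : NonZero N}} → (Fin N → A) → ℕ → A
cycle N u i = u (i mod N)

cycle-periodic : ∀ {A : Set} N .{{_ : NonZero N}} (u : Fin N → A) i → cycle N u (i + N) ≡ cycle N u i
cycle-periodic N u i = cong u (mod-shift N i)

cycle-start : ∀ {A : Set} N .{{_ : NonZero N}} (u : Fin N → A) k → cycle N u (toℕ k) ≡ u k
cycle-start N u k = cong u (toℕ-injective (mod-small (toℕ<n k)))

splice : ∀ {A : Set} → ℕ → (ℕ → A) → (ℕ → A) → ℕ → A
splice N f g i with i <? N
... | yes _ = f i
... | no  _ = g i

splice-left : ∀ {A : Set} {N i} (f g : ℕ → A) → i < N → splice N f g i ≡ f i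
splice-left {N = N} {i} f g i<N with i <? N
... | yes _   = refl
... | no  i≮N = contradiction i<N i≮N

splice-right : ∀ {A : Set} {N i} (f g : ℕ → A) → N ≤ i → splice N f g i ≡ g i
splice-right {N = N} {i} f g N≤i with i <? N
... | yes i<N = contradiction i<N (≤⇒≯ N≤i)
... | no  _   = refl

splice-both : ∀ {A : Set} {N i} (P : A → Set) (f g : ℕ → A) → P (f i) → P (g i) → P (splice N f g i)
splice-both {N = N} {i} P f g Pf Pg with i <? N
... | yes _ = Pf
... | no  _ = Pg

splice-accepts : ∀ {m} {kind : Letter m → Kind} {A : VPA m} {α β : Word m} N →
                 (acc-α : BAccepts kind A α) (acc-β : BAccepts kind A β) →
                 proj₁ acc-α N ≡ proj₁ acc-β N → BAccepts kind A (splice N α β)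
splice-accepts {kind = kind} {A} {α} {β} N
  (ρ , ρ-init , ρ-empty , ρ-step , _) (σ , σ-init , σ-empty , σ-step , σ-final) meet =
  splice N ρ σ ,
  splice-both {N = N} (λ c → VPA.init A (proj₁ c) ≡ true) ρ σ ρ-init σ-init ,
  splice-both {N = N} (λ c → proj₂ c ≡ []) ρ σ ρ-empty σ-empty ,
  step , final
  where
  step : ∀ i → Step kind A (splice N α β i) (splice N ρ σ i) (splice N ρ σ (suc i))
  step i with <-cmp (suc i) N
  ... | tri< i+1<N _ _
    rewrite splice-left α β (<⇒≤ i+1<N) | splice-left ρ σ (<⇒≤ i+1<N) | splice-left ρ σ i+1<N
    = ρ-step i
  ... | tri≈ _ refl _
    rewrite splice-left α β (≤-refl {suc i}) | splice-left ρ σ (≤-refl {suc i})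
          | splice-right ρ σ (≤-refl {suc i})
    = subst (Step kind A (α i) (ρ i)) meet (ρ-step i)
  ... | tri> _ _ N<i+1
    rewrite splice-right α β (≤-pred N<i+1) | splice-right ρ σ (≤-pred N<i+1)
          | splice-right ρ σ (<⇒≤ N<i+1)
    = σ-step i

  final : ∀ i → Σ ℕ λ j → (i ≤ j) × (VPA.final A (proj₁ (splice N ρ σ j)) ≡ true)
  final i with σ-final (i + N)
  ... | j , i+N≤j , σ-final-j =
    j , ≤-trans (m≤m+n i N) i+N≤j ,
    subst (λ c → VPA.final A (proj₁ c) ≡ true)
          (sym (splice-right ρ σ (≤-trans (m≤n+m N i) i+N≤j))) σ-final-j

local-stack-empty : ∀ {m} {A : VPA m} {α} (acc : BAccepts allLocal A α) → ∀ i → proj₂ (proj₁ acc i) ≡ []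
local-stack-empty             (_ , _ , r-empty , _ , _) zero    = r-empty
local-stack-empty {A = A} acc@(_ , _ , _ , r-step , _)  (suc i) =
  trans (proj₂ (r-step i)) (local-stack-empty {A = A} acc i)

untested : ∀ {m n} → Fin n → Maybe (Formula m)
untested _ = nothing

anyPrefix : ∀ {m} → VPA m
anyPrefix = record { nQ = 1 ; nΓ = 0 ; δcall = λ _ _ _ _ → true ; δret = λ _ _ _ _ → true
                   ; δloc = λ _ _ _ → true ; init = λ _ → true ; final = λ _ → true }

counter : ∀ {m} → ℕ → VPA m
counter k = record { nQ = suc k ; nΓ = 0 ; δcall = λ _ _ _ _ → true ; δret = λ _ _ _ _ → true
                   ; δloc = λ q _ q′ → toℕ q′ ≡ᵇ suc (toℕ q)
                   ; init = λ q → toℕ q ≡ᵇ 0 ; final = λ q → toℕ q ≡ᵇ k }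

anyPrefix-relates : ∀ {m} (α : Word m) k l → InR allLocal α (tvpa anyPrefix untested) k l
anyPrefix-relates α k l =
  (λ _ → Fin.zero , []) , refl , refl , (λ _ _ → refl , refl) , refl , (λ _ _ → tt)

counter-relates : ∀ {m} (α : Word m) k l → InR allLocal α (tvpa (counter k) untested) l (l + k)
counter-relates α k l =
  (λ i → i mod suc k , []) , ≡⇒≡ᵇ-true (mod-small {suc k} {0} (s≤s z≤n)) , refl , step , final , (λ _ _ → tt)
  where
  step : ∀ i → i < l + k ∸ l →
         Step allLocal (counter k) (α (l + i)) (i mod suc k , []) (suc i mod suc k , [])
  step i i<len rewrite m+n∸m≡n l k =
    ≡⇒≡ᵇ-true (trans (mod-small (s≤s i<len)) (cong suc (sym (mod-small (m≤n⇒m≤1+n i<len))))) , refl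
  final : (toℕ ((l + k ∸ l) mod suc k) ≡ᵇ k) ≡ true
  final rewrite m+n∸m≡n l k = ≡⇒≡ᵇ-true (mod-small (n<1+n k))

counter-exact : ∀ {m} (α : Word m) k {l l′} → l ≤ l′ →
                InR allLocal α (tvpa (counter k) untested) l l′ → l′ ≡ l + k
counter-exact α k {l} {l′} l≤l′ (r , r-init , _ , r-step , r-final , _) = begin
  l′             ≡⟨ sym (m+[n∸m]≡n l≤l′) ⟩
  l + (l′ ∸ l)   ≡⟨ cong (l +_) (sym (state-counts (l′ ∸ l) ≤-refl)) ⟩
  l + toℕ (proj₁ (r (l′ ∸ l))) ≡⟨ cong (l +_) (≡ᵇ-true⇒≡ r-final) ⟩
  l + k          ∎
  where
  open ≡-Reasoning
  state-counts : ∀ i → i ≤ l′ ∸ l → toℕ (proj₁ (r i)) ≡ i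
  state-counts zero    _   = ≡ᵇ-true⇒≡ r-init
  state-counts (suc i) i<n =
    trans (≡ᵇ-true⇒≡ (proj₁ (r-step i i<n))) (cong suc (state-counts i (<⇒≤ i<n)))

p : Formula 1
p = atom Fin.zero

now-and-after : ℕ → Formula 1 → Formula 1
now-and-after k χ = χ ∧ᶠ (⟨ tvpa (counter k) untested ⟩ χ)

periodic : ℕ → Formula 1
periodic k = [ tvpa anyPrefix untested ] (now-and-after k p ∨ᶠ now-and-after k (¬ᶠ p))

now-and-after-sound : ∀ {α l k} χ → Sat allLocal α l (now-and-after k χ) →
                      Sat allLocal α l χ × Sat allLocal α (l + k) χ
now-and-after-sound {α} {l} {k} χ (now , l′ , l≤l′ , related , later) =
  now , subst (λ j → Sat allLocal α j χ) (counter-exact α k l≤l′ related) later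

now-and-after-complete : ∀ {α l k} χ → Sat allLocal α l χ → Sat allLocal α (l + k) χ →
                         Sat allLocal α l (now-and-after k χ)
now-and-after-complete {α} {l} {k} _ now later = now , l + k , m≤m+n l k , counter-relates α k l , later

same-letter : ∀ {a b : Letter 1} →
              (Fin.zero ∈ a × Fin.zero ∈ b) ⊎ (Fin.zero ∉ a × Fin.zero ∉ b) → a ≡ b
same-letter {inside  ∷ []} {inside  ∷ []} _                  = refl
same-letter {outside ∷ []} {outside ∷ []} _                  = refl
same-letter {inside  ∷ []} {outside ∷ []} (inj₁ (_ , ()))
same-letter {inside  ∷ []} {outside ∷ []} (inj₂ (p∉a , _))   = ⊥-elim (p∉a here)
same-letter {outside ∷ []} {inside  ∷ []} (inj₁ (() , _))
same-letter {outside ∷ []} {inside  ∷ []} (inj₂ (_ , p∉b))   = ⊥-elim (p∉b here)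

periodic-sound : ∀ {k} α → Lang allLocal (periodic k) α → ∀ l → α (l + k) ≡ α l
periodic-sound α holds l with holds l z≤n (anyPrefix-relates α 0 l)
... | inj₁ agree-p     = sym (same-letter (inj₁ (now-and-after-sound p agree-p)))
... | inj₂ agree-not-p = sym (same-letter (inj₂ (now-and-after-sound (¬ᶠ p) agree-not-p)))

periodic-complete : ∀ {k} α → (∀ l → α (l + k) ≡ α l) → Lang allLocal (periodic k) α
periodic-complete α period l _ _ with Fin.zero ∈? α l
... | yes p∈ = inj₁ (now-and-after-complete p p∈ (subst (Fin.zero ∈_) (sym (period l)) p∈))
... | no  p∉ = inj₂ (now-and-after-complete (¬ᶠ p) p∉ (p∉ ∘ subst (Fin.zero ∈_) (period l)))

counter-size : ∀ k → sizeA (tvpa (counter {1} k) untested) ≡ suc k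
counter-size k = trans (cong (suc k +_) (all-zero (suc k))) (+-identityʳ (suc k))
  where
  all-zero : ∀ n → sumFin n (λ _ → 0) ≡ 0
  all-zero zero    = refl
  all-zero (suc n) = all-zero n

-- Twelve formula nodes, the single state of anyPrefix and the k + 1
-- states of each of the two copies of counter k.
size-periodic : ∀ k → size (periodic k) ≡ 2 * k + 15
size-periodic k = begin
  size (periodic k)                            ≡⟨⟩
  6 + (size-counter + 1 + (4 + (size-counter + 2))) ≡⟨ cong (λ s → 6 + (s + 1 + (4 + (s + 2)))) (counter-size k) ⟩
  6 + (suc k + 1 + (4 + (suc k + 2)))          ≡⟨ arithmetic k ⟩
  2 * k + 15                                   ∎
  where
  open ≡-Reasoning
  size-counter : ℕ
  size-counter = sizeA (tvpa (counter {1} k) untested)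
  arithmetic : ∀ k → 6 + (suc k + 1 + (4 + (suc k + 2))) ≡ 2 * k + 15
  arithmetic = solve-∀

-- Polynomial absorption: x + 1 ≤ (x + 1)^c ≤ c · (x + 1)^c for c ≥ 1.
-- Stated for a variable c, since a literal exponent makes the
-- typechecker unfold the powers.
base≤power : ∀ x c .{{_ : NonZero c}} → suc x ≤ suc x ^ c
base≤power x (suc c) = m≤m*n (suc x) (suc x ^ c) {{m^n≢0 (suc x) c}}

base≤poly : ∀ x c .{{_ : NonZero c}} → suc x ≤ c * suc x ^ c
base≤poly x c = ≤-trans (base≤power x c) (m≤n*m (suc x ^ c) c)

linear≤poly : ∀ x c .{{_ : NonZero c}} → c * suc x ≤ c * suc x ^ c
linear≤poly x c = *-monoʳ-≤ c (base≤power x c)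

size-linear : ∀ n → size (periodic n) ≤ 20 * suc n
size-linear n = begin
  size (periodic n) ≡⟨ size-periodic n ⟩
  2 * n + 15        ≤⟨ +-mono-≤ (*-monoˡ-≤ n (m≤m+n 2 18)) (m≤m+n 15 5) ⟩
  20 * n + 20       ≡⟨ arithmetic n ⟩
  20 * suc n        ∎
  where
  open ≤-Reasoning
  arithmetic : ∀ n → 20 * n + 20 ≡ 20 * suc n
  arithmetic = solve-∀

bitLetter : Fin 2 → Letter 1
bitLetter Fin.zero       = outside ∷ []
bitLetter (Fin.suc Fin.zero) = inside ∷ []

bitLetter-injective : Injective _≡_ _≡_ bitLetter
bitLetter-injective {Fin.zero}           {Fin.zero}           _  = refl
bitLetter-injective {Fin.suc Fin.zero}   {Fin.suc Fin.zero}   _  = refl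
bitLetter-injective {Fin.zero}           {Fin.suc Fin.zero}   ()
bitLetter-injective {Fin.suc Fin.zero}   {Fin.zero}           ()

finToFun-injective : ∀ {m n} {x y : Fin (m ^ n)} → finToFun x ≗ finToFun y → x ≡ y
finToFun-injective {m} {n} {x} {y} same =
  trans (sym (funToFin-finToFin {n} {m} x)) (trans (funToFin-cong {n} same) (funToFin-finToFin {n} {m} y))
  where
  funToFin-cong : ∀ {k} {f g : Fin k → Fin m} → f ≗ g → funToFin f ≡ funToFin g
  funToFin-cong {zero}  _   = refl
  funToFin-cong {suc k} f≗g = cong₂ combine (f≗g Fin.zero) (funToFin-cong (f≗g ∘ Fin.suc))

-- A BVPA recognizing the (N = n + 1)-periodic words has ≥ 2^N states:
-- the state at position N on the cyclic word of letters x determines x.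
module StateCount (n : ℕ) (A : VPA 1) (recognizes : Recognizes allLocal A (Lang allLocal (periodic (suc n)))) where
  N : ℕ
  N = suc n

  letters : Fin (2 ^ N) → Fin N → Letter 1
  letters x = bitLetter ∘ finToFun x

  word : Fin (2 ^ N) → Word 1
  word x = cycle N (letters x)

  accepting : ∀ x → BAccepts allLocal A (word x)
  accepting x = Equivalence.from (recognizes (word x)) (periodic-complete (word x) (cycle-periodic N (letters x)))

  stateAt : Fin (2 ^ N) → Fin (VPA.nQ A)
  stateAt x = proj₁ (proj₁ (accepting x) N)

  stateAt-injective : Injective _≡_ _≡_ stateAt
  stateAt-injective {x} {y} same-state = finToFun-injective {2} {N} same-bits
    where
    mixed : Word 1
    mixed = splice N (word x) (word y)

    meet : proj₁ (accepting x) N ≡ proj₁ (accepting y) N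
    meet = cong₂ _,_ same-state (trans (local-stack-empty {A = A} (accepting x) N)
                                       (sym (local-stack-empty {A = A} (accepting y) N)))

    mixed-periodic : ∀ l → mixed (l + N) ≡ mixed l
    mixed-periodic = periodic-sound mixed
      (Equivalence.to (recognizes mixed) (splice-accepts {kind = allLocal} {A = A} {word x} {word y} N (accepting x) (accepting y) meet))

    same-bits : finToFun x ≗ finToFun y
    same-bits k = bitLetter-injective (begin
      bitLetter (finToFun x k) ≡⟨ sym (cycle-start N (letters x) k) ⟩
      word x (toℕ k)           ≡⟨ sym (splice-left (word x) (word y) (toℕ<n k)) ⟩
      mixed (toℕ k)            ≡⟨ sym (mixed-periodic (toℕ k)) ⟩
      mixed (toℕ k + N)        ≡⟨ splice-right (word x) (word y) (m≤n+m N (toℕ k)) ⟩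
      word y (toℕ k + N)       ≡⟨ cycle-periodic N (letters y) (toℕ k) ⟩
      word y (toℕ k)           ≡⟨ cycle-start N (letters y) k ⟩
      bitLetter (finToFun y k) ∎)
      where open ≡-Reasoning

  enough-states : 2 ^ N ≤ VPA.nQ A
  enough-states = injective⇒≤ stateAt-injective

periodic-lower-bound : ∀ n (A : VPA 1) → Recognizes allLocal A (Lang allLocal (periodic n)) →
                       2 ^ n ≤ suc (VPA.nQ A)
periodic-lower-bound zero    A _          = s≤s z≤n
periodic-lower-bound (suc n) A recognizes = m≤n⇒m≤1+n (StateCount.enough-states n A recognizes)

lemma6 : Σ PushdownAlphabet λ Σ̃ → Σ ℕ λ c → (n : ℕ) →
    Σ (Formula (PushdownAlphabet.m Σ̃)) λ φ →
    (size φ ≤ c * suc n ^ c)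
    × ((A : VPA (PushdownAlphabet.m Σ̃)) →
    Recognizes (PushdownAlphabet.kind Σ̃) A (Lang (PushdownAlphabet.kind Σ̃) φ) →
    2 ^ n ≤ c * suc (VPA.nQ A) ^ c)
lemma6 = localAlphabet , 20 , λ n →
  periodic n , ≤-trans (size-linear n) (linear≤poly n 20) ,
  λ A recognizes → ≤-trans (periodic-lower-bound n A recognizes) (base≤poly (VPA.nQ A) 20)
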